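{- Let $K$ be a number field with ring of integers $\mathcal O$, let $M\subseteq\mathcal O^m$ be an $\mathcal O$-submodule and $\mathfrak m$ a non-zero integral ideal with $\mathfrak m\mathcal O^m\subseteq M$. Let $\pi_\mathfrak m$ denote reduction modulo $\mathfrak m$ on $\mathcal O^m$ and on matrices. Let $C\in\mathcal O^{m\times m}$ be such that $\pi_\mathfrak m(C)$ is a strong echelon form of $\pi_\mathfrak m(M)\subseteq(\mathcal O/\mathfrak m)^m$. Let $D\in\mathcal O^{2m\times m}$ be the matrix whose first $m$ rows are the rows $C_1,\dots,C_m$ of $C$ and whose last $m$ rows are the rows of the $m\times m$ identity matrix, and let $I=(\mathcal O,\dots,\mathcal O,\mathfrak m,\dots,\mathfrak m)$ ($m$ copies of $\mathcal O$ followed by $m$ copies of $\mathfrak m$). Then the pseudomatrix $(I,D)$ has span $M$, i.e. $M=\sum_{i=1}^m\mathcal O\,C_i+\sum_{i=1}^m\mathfrak m\,e_i$, where $e_i$ is the $i$-th standard basis vector.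
   Context: For a ring $R$, a submodule $M\subseteq R^m$ and $0\le k\le m$, $S_k(M)$ is the set of elements of $M$ whose last $k$ entries are zero. A matrix $H=(h_{ij})\in R^{n\times m}$, $n\ge m$, is a strong echelon form of $M$ if (S1) for $1\le i\le m$ the $i$-th row is zero or $i=\max\{j\mid h_{ij}\ne0\}$, and for $i>m$ the $i$-th row is zero; and (S2) for $1\le i\le m$ rows $1,\dots,i$ generate $S_{m-i}(M)$. A pseudomatrix is a pair $((\mathfrak a_i)_{1\le i\le n},A)$ of fractional ideals $\mathfrak a_i$ of $K$ and a matrix $A\in K^{n\times m}$ with rows $A_i$; its span is $\sum_i\mathfrak a_iA_i$. -}

module Defs where

open import Level using (Level; _⊔_; suc)
open import Algebra.Bundles using (CommutativeRing)
open import Data.Nat using (ℕ; _≤_; _<_)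
open import Data.Fin using (Fin; toℕ; inject≤; splitAt)
open import Data.Sum using (_⊎_; inj₁; inj₂)
open import Data.Product using (_×_; Σ; ∃)
open import Relation.Nullary using (¬_)
open import Function.Bundles using (_⇔_)

module _ {c ℓ : Level} (R : CommutativeRing c ℓ) where
  open CommutativeRing R
  open import Algebra.Definitions.RawMonoid +-rawMonoid using (sum)

  -- vectors in R^m, matrices as rows-then-columns
  Vec' : ℕ → Set c
  Vec' m = Fin m → Carrier

  record Ideal (p : Level) : Set (c ⊔ ℓ ⊔ suc p) where
    field
      _∈ᵢ_    : Carrier → Set p
      ∈-resp  : ∀ {x y} → x ≈ y → _∈ᵢ_ x → _∈ᵢ_ y
      0∈      : _∈ᵢ_ 0#
      +-closed : ∀ {x y} → _∈ᵢ_ x → _∈ᵢ_ y → _∈ᵢ_ (x + y)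
      *-closed : ∀ r {x} → _∈ᵢ_ x → _∈ᵢ_ (r * x)

  unitIdeal : Ideal c
  unitIdeal = record
    { _∈ᵢ_ = λ _ → Level.Lift c Data.Unit.⊤
    ; ∈-resp = λ _ _ → Level.lift Data.Unit.tt
    ; 0∈ = Level.lift Data.Unit.tt
    ; +-closed = λ _ _ → Level.lift Data.Unit.tt
    ; *-closed = λ _ _ → Level.lift Data.Unit.tt }
    where import Data.Unit

  NonZeroIdeal : ∀ {p} → Ideal p → Set (c ⊔ ℓ ⊔ p)
  NonZeroIdeal 𝔪 = Σ Carrier λ x → Ideal._∈ᵢ_ 𝔪 x × ¬ (x ≈ 0#)

  record Submodule (m : ℕ) (p : Level) : Set (c ⊔ ℓ ⊔ suc p) where
    field
      _∈ₘ_     : Vec' m → Set p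
      ∈-resp   : ∀ {v w} → (∀ j → v j ≈ w j) → _∈ₘ_ v → _∈ₘ_ w
      0∈       : _∈ₘ_ (λ _ → 0#)
      +-closed : ∀ {v w} → _∈ₘ_ v → _∈ₘ_ w → _∈ₘ_ (λ j → v j + w j)
      *-closed : ∀ r {v} → _∈ₘ_ v → _∈ₘ_ (λ j → r * v j)

  module _ {p q : Level} (𝔪 : Ideal p) where
    open Ideal 𝔪

    -- congruence modulo 𝔪 (equality after reduction π_𝔪 into R/𝔪)
    _≡[mod]_ : Carrier → Carrier → Set p
    x ≡[mod] y = _∈ᵢ_ (x - y)

    _·Rᵐ⊆_ : ∀ {m} → Submodule m q → Set (c ⊔ p ⊔ q)
    _·Rᵐ⊆_ {m} M = ∀ (v : Vec' m) → (∀ j → _∈ᵢ_ (v j)) → Submodule._∈ₘ_ M v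

    -- membership of (the class of) v in π_𝔪(M) ⊆ (R/𝔪)^m
    _∈π_ : ∀ {m} → Vec' m → Submodule m q → Set (c ⊔ p ⊔ q)
    v ∈π M = Σ (Vec' _) λ w → Submodule._∈ₘ_ M w × (∀ j → v j ≡[mod] w j)

    -- S_k(π_𝔪(M)): elements of π_𝔪(M) whose last k entries are zero in R/𝔪
    _∈S[_]π_ : ∀ {m} → Vec' m → ℕ → Submodule m q → Set (c ⊔ p ⊔ q)
    _∈S[_]π_ {m} v k M = (v ∈π M) × (∀ (j : Fin m) → m Data.Nat.∸ k ≤ toℕ j → v j ≡[mod] 0#)

    InRowSpan : ∀ {m} (H : Fin m → Vec' m) (i : ℕ) → i ≤ m → Vec' m → Set (c ⊔ p)
    InRowSpan {m} H i i≤m v =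
      Σ (Fin i → Carrier) λ a → ∀ (j : Fin m) →
        v j ≡[mod] sum (λ k → a k * H (inject≤ k i≤m) j)

    record IsStrongEchelonModπ {m} (H : Fin m → Vec' m) (M : Submodule m q)
                               : Set (c ⊔ ℓ ⊔ p ⊔ q) where
      field
        -- (S1): row i is zero, or i = max { j | h_ij ≠ 0 } (in R/𝔪)
        S1 : ∀ (i : Fin m) →
               (∀ j → H i j ≡[mod] 0#)
             ⊎ ((¬ (H i i ≡[mod] 0#)) × (∀ j → ¬ (H i j ≡[mod] 0#) → toℕ j ≤ toℕ i))
        S2 : ∀ (i : ℕ) (1≤i : 1 ≤ i) (i≤m : i ≤ m) (v : Vec' m) →
               (v ∈S[ m Data.Nat.∸ i ]π M) ⇔ InRowSpan H i i≤m v

  _∈PseudoSpan[_,_] : ∀ {p m n} → Vec' m → (Fin n → Ideal p) → (Fin n → Vec' m) → Set (c ⊔ ℓ ⊔ p)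
  _∈PseudoSpan[_,_] {n = n} v 𝔞 A =
    Σ (Fin n → Carrier) λ x → (∀ i → Ideal._∈ᵢ_ (𝔞 i) (x i))
      × (∀ j → v j ≈ sum (λ i → x i * A i j))

  identity : ∀ {m} → Fin m → Vec' m
  identity i j with i Data.Fin.≟ j
  ... | Relation.Nullary.yes _ = 1#
  ... | Relation.Nullary.no _ = 0#
    where import Data.Fin

  stackD : ∀ {m} → (Fin m → Vec' m) → Fin (m Data.Nat.+ m) → Vec' m
  stackD {m} C r with splitAt m r
  ... | inj₁ i = C i
  ... | inj₂ i = identity i

  stackI : ∀ {m} → Ideal c → Fin (m Data.Nat.+ m) → Ideal c
  stackI {m} 𝔪 r with splitAt m r
  ... | inj₁ _ = unitIdeal
  ... | inj₂ _ = 𝔪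

module Submission where

open import Defs
open import Level using (Level; _⊔_)
open import Algebra.Bundles using (CommutativeRing)
open import Data.Nat using (ℕ; zero; suc; _∸_; s≤s; z≤n)
open import Data.Nat.Properties using (≤-refl; n∸n≡0; <⇒≱)
open import Data.Fin using (Fin; zero; suc; toℕ; _↑ˡ_; _↑ʳ_; splitAt; inject≤; punchIn; _≟_)
open import Data.Fin.Properties using (splitAt-↑ˡ; splitAt-↑ʳ; inject≤-refl; punchInᵢ≢i; toℕ<n)
open import Data.Vec.Functional using (_++_)
open import Data.Vec.Functional.Properties using (lookup-++ˡ; lookup-++ʳ)
open import Data.Sum using (inj₁; inj₂)
open import Data.Product using (Σ; _×_; _,_; proj₁)
open import Function.Bundles using (_⇔_; mk⇔; Equivalence)
open import Function.Construct.Composition using (_⇔-∘_)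
open import Function.Construct.Symmetry using (⇔-sym)
open import Relation.Binary.PropositionalEquality as ≡ using (_≡_; _≢_)
open import Relation.Nullary using (yes; no; contradiction)

module _ {c ℓ : Level} (R : CommutativeRing c ℓ) where
  open CommutativeRing R hiding (zero)
  open import Algebra.Properties.CommutativeMonoid.Sum +-commutativeMonoid
    using (sum; sum-remove; sum-cong-≋; sum-cong-≗; sum-replicate-zero)
  open import Relation.Binary.Reasoning.Setoid setoid

  y+[x-y]≈x : ∀ x y → y + (x - y) ≈ x
  y+[x-y]≈x x y = begin
    y + (x - y)   ≈⟨ +-congˡ (+-comm x (- y)) ⟩
    y + (- y + x) ≈⟨ sym (+-assoc y (- y) x) ⟩
    (y - y) + x   ≈⟨ +-congʳ (-‿inverseʳ y) ⟩
    0# + x        ≈⟨ +-identityˡ x ⟩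
    x             ∎

  sum-↑ : ∀ a b (f : Fin (a Data.Nat.+ b) → Carrier) →
          sum f ≈ sum (λ k → f (k ↑ˡ b)) + sum (λ k → f (a ↑ʳ k))
  sum-↑ zero    b f = sym (+-identityˡ _)
  sum-↑ (suc a) b f =
    trans (+-congˡ (sum-↑ a b (λ k → f (suc k)))) (sym (+-assoc _ _ _))

  identity-diag : ∀ {m} (i : Fin m) → identity R i i ≈ 1#
  identity-diag i with i ≟ i
  ... | yes _ = refl
  ... | no i≢i = contradiction ≡.refl i≢i

  identity-off : ∀ {m} {i j : Fin m} → i ≢ j → identity R i j ≈ 0#
  identity-off {i = i} {j} i≢j with i ≟ j
  ... | yes i≡j = contradiction i≡j i≢j
  ... | no _ = refl

  sum-identityʳ : ∀ {m} (y : Fin m → Carrier) (j : Fin m) →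
                  sum (λ i → y i * identity R i j) ≈ y j
  sum-identityʳ {suc n} y j = begin
    sum t                                ≈⟨ sum-remove {i = j} t ⟩
    t j + sum (λ k → t (punchIn j k))    ≈⟨ +-cong diagonal off-diagonal ⟩
    y j + 0#                             ≈⟨ +-identityʳ (y j) ⟩
    y j                                  ∎
    where
    t : Fin (suc n) → Carrier
    t i = y i * identity R i j
    diagonal : t j ≈ y j
    diagonal = trans (*-congˡ (identity-diag j)) (*-identityʳ (y j))
    off-diagonal : sum (λ k → t (punchIn j k)) ≈ 0#
    off-diagonal = trans
      (sum-cong-≋ {n} (λ k → trans (*-congˡ (identity-off (punchInᵢ≢i j k))) (zeroʳ _)))
      (sum-replicate-zero n)

  sum-identityˡ : ∀ {m} (y : Fin m → Carrier) (k : Fin m) →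
                  sum (λ i → identity R i k * y i) ≈ y k
  sum-identityˡ {m} y k =
    trans (sum-cong-≋ {m} (λ i → *-comm (identity R i k) (y i))) (sum-identityʳ y k)

  combination : ∀ {m n} → (Fin n → Carrier) → (Fin n → Vec' R m) → Vec' R m
  combination a C j = sum (λ k → a k * C k j)

  module _ {m : ℕ} {q : Level} (M : Submodule R m q) where
    open Submodule M renaming (_∈ₘ_ to _∈M)

    ∈-sum : ∀ {n} (f : Fin n → Vec' R m) → (∀ r → f r ∈M) →
            (λ j → sum (λ r → f r j)) ∈M
    ∈-sum {zero}  f f∈M = 0∈
    ∈-sum {suc n} f f∈M = +-closed (f∈M zero) (∈-sum (λ r → f (suc r)) (λ r → f∈M (suc r)))

    ∈-combination : ∀ {n} (a : Fin n → Carrier) (C : Fin n → Vec' R m) →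
                    (∀ k → C k ∈M) → combination a C ∈M
    ∈-combination a C C∈M = ∈-sum (λ k j → a k * C k j) (λ k → *-closed (a k) (C∈M k))

  InRowsPlusIdeal : ∀ {p m} → Ideal R p → (Fin m → Vec' R m) → Vec' R m → Set (c ⊔ ℓ ⊔ p)
  InRowsPlusIdeal {m = m} 𝔪 C v =
    Σ (Fin m → Carrier) λ a → Σ (Vec' R m) λ t →
      (∀ j → Ideal._∈ᵢ_ 𝔪 (t j)) × (∀ j → v j ≈ combination a C j + t j)

  module _ {p : Level} (𝔪 : Ideal R p) where
    open Ideal 𝔪 using (∈-resp; 0∈) renaming (_∈ᵢ_ to _∈ᵢ)

    _≡ₘ_ : Carrier → Carrier → Set p
    x ≡ₘ y = (x - y) ∈ᵢ

    ≡ₘ-refl : ∀ x → x ≡ₘ x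
    ≡ₘ-refl x = ∈-resp (sym (-‿inverseʳ x)) 0∈

    InFullRowSpan : ∀ {m} → (Fin m → Vec' R m) → Vec' R m → Set (c ⊔ p)
    InFullRowSpan {m} C v =
      Σ (Fin m → Carrier) λ a → ∀ j → v j ≡ₘ combination a C j

    -- If 𝔪Rᵐ ⊆ M, reduction mod 𝔪 loses no information about membership:
    -- v ≡ w (mod 𝔪) with w ∈ M gives v = w + (v - w) ∈ M.
    ∈π⇒∈ : ∀ {m q} {M : Submodule R m q} → _·Rᵐ⊆_ R {q = q} 𝔪 M →
           ∀ {v} → _∈π_ R {q = q} 𝔪 v M → Submodule._∈ₘ_ M v
    ∈π⇒∈ {M = M} 𝔪Rᵐ⊆M {v} (w , w∈M , v≡w) = Submodule.∈-resp M (λ j → y+[x-y]≈x (v j) (w j))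
      (Submodule.+-closed M w∈M (𝔪Rᵐ⊆M (λ j → v j - w j) v≡w))

    -- No coordinate j : Fin m satisfies m ∸ (m ∸ m) ≤ j, so S_{m-m}(π M) = π M.
    ∈π⇒∈S₀ : ∀ {m q} {M : Submodule R m q} {v} →
             _∈π_ R {q = q} 𝔪 v M → _∈S[_]π_ R {q = q} 𝔪 v (m ∸ m) M
    ∈π⇒∈S₀ {m} v∈πM = v∈πM , λ j m≤j →
      contradiction (≡.subst (λ k → m ∸ k Data.Nat.≤ toℕ j) (n∸n≡0 m) m≤j) (<⇒≱ (toℕ<n j))

    -- Condition (S2) at i = m: the rows of C span π_𝔪(M).  (For m = 0 both
    -- sides hold trivially.)
    echelon-spans : ∀ {m q} {M : Submodule R m q} {C} → IsStrongEchelonModπ R {q = q} 𝔪 C M →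
                    ∀ v → _∈π_ R {q = q} 𝔪 v M ⇔ InFullRowSpan C v
    echelon-spans {zero} {M = M} E v =
      mk⇔ (λ _ → (λ ()) , (λ ())) (λ _ → (λ _ → 0#) , Submodule.0∈ M , (λ ()))
    echelon-spans {suc n} {q} {M} {C} E v = mk⇔ to from
      where
      open IsStrongEchelonModπ E using (S2)
      S2ₘ = S2 (suc n) (s≤s z≤n) ≤-refl v
      reindex : ∀ a j → sum (λ k → a k * C (inject≤ k ≤-refl) j) ≡ combination a C j
      reindex a j = sum-cong-≗ {suc n} (λ k → ≡.cong (λ k′ → a k * C k′ j) (inject≤-refl k ≤-refl))
      to : _∈π_ R {q = q} 𝔪 v M → InFullRowSpan C v
      to v∈πM with Equivalence.to S2ₘ (∈π⇒∈S₀ {M = M} v∈πM)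
      ... | a , v≡aC = a , λ j → ≡.subst (v j ≡ₘ_) (reindex a j) (v≡aC j)
      from : InFullRowSpan C v → _∈π_ R {q = q} 𝔪 v M
      from (a , v≡aC) = proj₁ (Equivalence.from S2ₘ
        (a , λ j → ≡.subst (v j ≡ₘ_) (≡.sym (reindex a j)) (v≡aC j)))

    -- Each row Cₖ = Σₗ δₗₖ Cₗ lies in π_𝔪(M), hence in M.
    rows-∈ : ∀ {m q} {M : Submodule R m q} → _·Rᵐ⊆_ R {q = q} 𝔪 M →
             ∀ {C} → IsStrongEchelonModπ R {q = q} 𝔪 C M → ∀ k → Submodule._∈ₘ_ M (C k)
    rows-∈ {M = M} 𝔪Rᵐ⊆M {C} E k =
      ∈π⇒∈ {M = M} 𝔪Rᵐ⊆M (Equivalence.from (echelon-spans E (C k))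
        ((λ l → identity R l k) , λ j → ∈-resp (sym (C≡δC j)) 0∈))
      where
      C≡δC : ∀ j → C k j - combination (λ l → identity R l k) C j ≈ 0#
      C≡δC j = trans (+-congˡ (-‿cong (sum-identityˡ (λ l → C l j) k))) (-‿inverseʳ (C k j))

    rows-plus-ideal : ∀ {m q} {M : Submodule R m q} → _·Rᵐ⊆_ R {q = q} 𝔪 M →
      ∀ {C} → IsStrongEchelonModπ R {q = q} 𝔪 C M →
      ∀ v → Submodule._∈ₘ_ M v ⇔ InRowsPlusIdeal 𝔪 C v
    rows-plus-ideal {M = M} 𝔪Rᵐ⊆M {C} E v = mk⇔ to from
      where
      -- v ∈ π(M) trivially, so v ≡ Σ aₖ Cₖ (mod 𝔪) and v = Σ aₖ Cₖ + (v - Σ aₖ Cₖ).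
      to : Submodule._∈ₘ_ M v → InRowsPlusIdeal 𝔪 C v
      to v∈M with Equivalence.to (echelon-spans E v) (v , v∈M , λ j → ≡ₘ-refl (v j))
      ... | a , v≡aC = a , (λ j → v j - combination a C j) , v≡aC ,
                       λ j → sym (y+[x-y]≈x (v j) (combination a C j))
      -- The rows of C and the vectors of 𝔪ᵐ all lie in M.
      from : InRowsPlusIdeal 𝔪 C v → Submodule._∈ₘ_ M v
      from (a , t , t∈𝔪 , v≈aC+t) = Submodule.∈-resp M (λ j → sym (v≈aC+t j))
        (Submodule.+-closed M (∈-combination M a C (rows-∈ {M = M} 𝔪Rᵐ⊆M E)) (𝔪Rᵐ⊆M t t∈𝔪))

  stackD-↑ˡ : ∀ {m} (C : Fin m → Vec' R m) k → stackD R C (k ↑ˡ m) ≡ C k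
  stackD-↑ˡ {m} C k rewrite splitAt-↑ˡ m k m = ≡.refl

  stackD-↑ʳ : ∀ {m} (C : Fin m → Vec' R m) i → stackD R C (m ↑ʳ i) ≡ identity R i
  stackD-↑ʳ {m} C i rewrite splitAt-↑ʳ m m i = ≡.refl

  stackI-↑ʳ : ∀ {m} (𝔪 : Ideal R c) i → stackI R {m = m} 𝔪 (m ↑ʳ i) ≡ 𝔪
  stackI-↑ʳ {m} 𝔪 i rewrite splitAt-↑ʳ m m i = ≡.refl

  stackD-combination : ∀ {m} (C : Fin m → Vec' R m) (x : Fin (m Data.Nat.+ m) → Carrier) j →
    combination x (stackD R C) j ≈ combination (λ k → x (k ↑ˡ m)) C j + x (m ↑ʳ j)
  stackD-combination {m} C x j = begin
    combination x (stackD R C) j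
      ≈⟨ sum-↑ m m (λ r → x r * stackD R C r j) ⟩
    sum (λ k → x (k ↑ˡ m) * stackD R C (k ↑ˡ m) j) + sum (λ i → x (m ↑ʳ i) * stackD R C (m ↑ʳ i) j)
      ≡⟨ ≡.cong₂ _+_ (sum-cong-≗ {m} (λ k → ≡.cong (λ row → x (k ↑ˡ m) * row j) (stackD-↑ˡ C k)))
                     (sum-cong-≗ {m} (λ i → ≡.cong (λ row → x (m ↑ʳ i) * row j) (stackD-↑ʳ C i))) ⟩
    combination (λ k → x (k ↑ˡ m)) C j + sum (λ i → x (m ↑ʳ i) * identity R i j)
      ≈⟨ +-congˡ (sum-identityʳ (λ i → x (m ↑ʳ i)) j) ⟩
    combination (λ k → x (k ↑ˡ m)) C j + x (m ↑ʳ j) ∎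

  pseudoSpan-stack : ∀ {m} (𝔪 : Ideal R c) (C : Fin m → Vec' R m) v →
    _∈PseudoSpan[_,_] R v (stackI R {m = m} 𝔪) (stackD R C) ⇔ InRowsPlusIdeal 𝔪 C v
  pseudoSpan-stack {m} 𝔪 C v = mk⇔ to from
    where
    to : _∈PseudoSpan[_,_] R v (stackI R {m = m} 𝔪) (stackD R C) → InRowsPlusIdeal 𝔪 C v
    to (x , x∈I , v≈xD) =
      (λ k → x (k ↑ˡ m)) , (λ i → x (m ↑ʳ i)) ,
      (λ i → ≡.subst (λ 𝔞 → Ideal._∈ᵢ_ 𝔞 (x (m ↑ʳ i))) (stackI-↑ʳ 𝔪 i) (x∈I (m ↑ʳ i))) ,
      (λ j → trans (v≈xD j) (stackD-combination C x j))
    from : InRowsPlusIdeal 𝔪 C v → _∈PseudoSpan[_,_] R v (stackI R {m = m} 𝔪) (stackD R C)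
    from (a , t , t∈𝔪 , v≈aC+t) = a ++ t , x∈I , λ j → begin
      v j
        ≈⟨ v≈aC+t j ⟩
      combination a C j + t j
        ≡⟨ ≡.cong₂ _+_ (sum-cong-≗ {m} (λ k → ≡.cong (_* C k j) (≡.sym (lookup-++ˡ a t k))))
                       (≡.sym (lookup-++ʳ a t j)) ⟩
      combination (λ k → (a ++ t) (k ↑ˡ m)) C j + (a ++ t) (m ↑ʳ j)
        ≈⟨ sym (stackD-combination C (a ++ t) j) ⟩
      combination (a ++ t) (stackD R C) j ∎
      where
      x∈I : ∀ r → Ideal._∈ᵢ_ (stackI R {m = m} 𝔪 r) ((a ++ t) r)
      x∈I r with splitAt m r
      ... | inj₁ _ = Level.lift _
      ... | inj₂ i = t∈𝔪 i

mainTheorem8 : ∀ {c ℓ q : Level} (R : CommutativeRing c ℓ) (m : ℕ)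
    (M : Submodule R m q) (𝔪 : Ideal R c) →
    NonZeroIdeal R 𝔪 →
    _·Rᵐ⊆_ R {q = q} 𝔪 M →
    (C : Fin m → Fin m → CommutativeRing.Carrier R) →
    IsStrongEchelonModπ R {q = q} 𝔪 C M →
    ∀ (v : Fin m → CommutativeRing.Carrier R) →
    Submodule._∈ₘ_ M v ⇔ _∈PseudoSpan[_,_] R v (stackI R {m = m} 𝔪) (stackD R {m = m} C)
mainTheorem8 R m M 𝔪 _ 𝔪Rᵐ⊆M C E v =
  ⇔-sym (pseudoSpan-stack R 𝔪 C v) ⇔-∘ rows-plus-ideal R 𝔪 {M = M} 𝔪Rᵐ⊆M E v
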